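{- Let $p\ge 5$ be a prime. A $\Phi_{\frac{p-1}{2}}$-sequence $(a_n)_{n\in\mathbb{Z}}$ in $\mathbb{F}_p$ is complete if and only if $a_n=b^n$ for all $n$, where $b$ is a $\Phi_{\frac{p-1}{2}}$-primitive root. Moreover, in this case $b=p-2$.
   Context: For a prime $p\ge 5$ and $\kappa\in\{2,\dots,p-2\}$, a sequence $(a_n)_{n\in\mathbb{Z}}$ of elements of $\mathbb{F}_p$ is a $\Phi_\kappa$-sequence if $a_0=1$ and $a_{n+\kappa}=a_n+a_{n+1}$ in $\mathbb{F}_p$ for all $n\in\mathbb{Z}$. It is complete if it is periodic with period $p-1$ and $\{a_1,\dots,a_{p-2}\}=\{2,\dots,p-1\}$. A $\Phi_\kappa$-primitive root is a primitive root $b$ mod $p$ (in $\mathbb{F}_p$) with $b^\kappa=b+1$. -}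

module Defs where

open import Data.Nat as ℕ using (ℕ; zero; suc; _≤_; _<_; _∸_; NonZero)
open import Data.Nat.DivMod using (_%_; m%n<n)
open import Data.Nat.Primality using (Prime; prime⇒nonZero)
open import Data.Integer as ℤ using (ℤ; +_; -[1+_])
open import Data.Fin using (Fin; toℕ; fromℕ<)
open import Data.Product using (Σ; _×_)
open import Relation.Binary.PropositionalEquality using (_≡_; _≢_)

module Fp (p : ℕ) (pr : Prime p) where
  private
    instance
      nz : NonZero p
      nz = prime⇒nonZero pr

  F : Set
  F = Fin p

  ⟦_⟧ : ℕ → F
  ⟦ m ⟧ = fromℕ< (m%n<n m p)

  1# : F
  1# = ⟦ 1 ⟧

  infixl 6 _+_
  infixl 7 _*_
  infixr 8 _^_

  _+_ : F → F → F
  x + y = ⟦ toℕ x ℕ.+ toℕ y ⟧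

  _*_ : F → F → F
  x * y = ⟦ toℕ x ℕ.* toℕ y ⟧

  _^_ : F → ℕ → F
  x ^ zero = 1#
  x ^ suc k = x * x ^ k

  -- x ≡ b^n for an integer exponent n; for negative n, b^n is the inverse of b^(-n)
  IsZPow : F → ℤ → F → Set
  IsZPow b (+ m) x = x ≡ b ^ m
  IsZPow b -[1+ m ] x = x * b ^ suc m ≡ 1#

  PhiSeq : ℕ → (ℤ → F) → Set
  PhiSeq κ a = (a (+ 0) ≡ 1#) × (∀ (n : ℤ) → a (n ℤ.+ + κ) ≡ a n + a (n ℤ.+ + 1))

  Complete : (ℤ → F) → Set
  Complete a =
    (∀ (n : ℤ) → a (n ℤ.+ + (p ∸ 1)) ≡ a n) ×
    (∀ (x : F) →
      ((Σ ℕ λ i → 1 ≤ i × i ≤ p ∸ 2 × a (+ i) ≡ x) → (2 ≤ toℕ x × toℕ x ≤ p ∸ 1)) ×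
      ((2 ≤ toℕ x × toℕ x ≤ p ∸ 1) → Σ ℕ λ i → 1 ≤ i × i ≤ p ∸ 2 × a (+ i) ≡ x))

  PrimitiveRoot : F → Set
  PrimitiveRoot b = (b ^ (p ∸ 1) ≡ 1#) × (∀ k → 1 ≤ k → k < p ∸ 1 → b ^ k ≢ 1#)

  PhiPrimRoot : ℕ → F → Set
  PhiPrimRoot κ b = PrimitiveRoot b × (b ^ κ ≡ b + 1#)

{-# OPTIONS --safe #-}
-- Let 2κ = p - 1. Unfolding the recurrence twice gives a(n + 2κ) = a(n) + 2a(n+1) + a(n+2), so a
-- sequence of period p - 1 satisfies a(n+2) = -2·a(n+1): it is geometric with ratio -2 = p - 2,
-- completeness forces -2 to be a primitive root, and the recurrence at n = 0 gives b^κ = b + 1.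
-- Conversely the powers b, …, b^(p-2) of a primitive root b are p - 2 distinct residues other
-- than 0 and 1, so by counting they exhaust {2, …, p - 1}.
module Submission where

open import Defs
open import Data.Nat using (ℕ; _≤_; _∸_; _/_)
open import Data.Nat.Primality using (Prime)
open import Data.Integer using (ℤ)
open import Data.Fin using (toℕ)
open import Data.Product using (Σ; _×_)
open import Relation.Binary.PropositionalEquality using (_≡_)

open import Algebra.Bundles using (CommutativeRing)
open import Data.Fin using (Fin; punchOut)
open import Data.Fin.Properties
  using (_≟_; any?; toℕ-fromℕ<; toℕ-injective; toℕ<n; toℕ≤pred[n]; punchOut-injective; injective⇒≤)
open import Data.Integer as ℤ using (+_; -[1+_])
import Data.Integer.Properties as ℤ
import Algebra.Properties.CommutativeSemigroup ℤ.+-commutativeSemigroup as ℤ+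
open import Data.Nat as ℕ using (zero; suc; NonZero; z≤n; s≤s)
open import Data.Nat.DivMod using (_%_; m%n<n; m≡m%n+[m/n]*n; %-distribˡ-+; %-distribˡ-*; n%n≡0; m<n⇒m%n≡m)
open import Data.Nat.Divisibility using (divides)
open import Data.Nat.Primality using (prime⇒nonZero; prime⇒nonTrivial; prime⇒irreducible)
import Data.Nat.Properties as ℕ
open import Data.Product using (_,_; proj₁; ∃; map₂)
open import Data.Sum using (inj₁; inj₂)
open import Function using (_∘_; Injective)
open import Level using (0ℓ)
open import Relation.Binary.Definitions using (tri<; tri≈; tri>)
open import Relation.Binary.PropositionalEquality
  using (_≢_; refl; sym; trans; cong; cong₂; subst; isEquivalence; module ≡-Reasoning)
open import Relation.Nullary using (yes; no; contradiction)

injective⇒surjective : ∀ {n} {f : Fin n → Fin n} → Injective _≡_ _≡_ f → ∀ y → ∃ λ x → f x ≡ y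
injective⇒surjective {suc n} {f} f-inj y with any? (λ x → f x ≟ y)
... | yes hit  = hit
... | no  miss = contradiction (injective⇒≤ g-inj) ℕ.1+n≰n
  where
  y≢f : ∀ x → y ≢ f x
  y≢f x y≡fx = miss (x , sym y≡fx)

  g : Fin (suc n) → Fin n
  g x = punchOut (y≢f x)

  g-inj : Injective _≡_ _≡_ g
  g-inj {x} {x′} eq = f-inj (punchOut-injective (y≢f x) (y≢f x′) eq)

injective∧avoids⇒covers-rest : ∀ {n} {f : Fin n → Fin (suc n)} {y₀} → Injective _≡_ _≡_ f →
                               (∀ x → f x ≢ y₀) → ∀ {y} → y ≢ y₀ → ∃ λ x → f x ≡ y
injective∧avoids⇒covers-rest {n} {f} {y₀} f-inj avoids {y} y≢y₀ =
  map₂ (punchOut-injective (y₀≢f _) (y≢y₀ ∘ sym)) (injective⇒surjective g-inj (punchOut (y≢y₀ ∘ sym)))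
  where
  y₀≢f : ∀ x → y₀ ≢ f x
  y₀≢f x = avoids x ∘ sym

  g : Fin n → Fin n
  g x = punchOut (y₀≢f x)

  g-inj : Injective _≡_ _≡_ g
  g-inj {x} {x′} eq = f-inj (punchOut-injective (y₀≢f x) (y₀≢f x′) eq)

oddPrime⇒pred≡half+half : ∀ {p} → Prime p → 2 ℕ.< p → p ∸ 1 ≡ (p ∸ 1) / 2 ℕ.+ (p ∸ 1) / 2
oddPrime⇒pred≡half+half {suc q} pr (s≤s (s≤s (s≤s _)))
  with q % 2 | m≡m%n+[m/n]*n q 2 | m%n<n q 2
... | 0 | q≡2h | _ = trans q≡2h (trans (ℕ.*-comm (q / 2) 2) (cong (q / 2 ℕ.+_) (ℕ.+-identityʳ (q / 2))))
-- otherwise 2 divides p = 2 (q / 2 + 1)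
... | 1 | q≡1+2h | _ with prime⇒irreducible pr (divides (suc (q / 2)) (cong suc q≡1+2h))
...   | inj₁ ()
...   | inj₂ ()
oddPrime⇒pred≡half+half _ _ | suc (suc _) | _ | s≤s (s≤s ())

module PrimeField (p : ℕ) (pr : Prime p) where
  open Fp p pr
  open ≡-Reasoning

  private instance
    p≢0 : NonZero p
    p≢0 = prime⇒nonZero pr

  private
    0<p : 0 ℕ.< p
    0<p = ℕ.n≢0⇒n>0 (ℕ.≢-nonZero⁻¹ p)

  0# : F
  0# = ⟦ 0 ⟧

  infix 8 -_
  -_ : F → F
  - x = ⟦ p ∸ toℕ x ⟧

  toℕ-⟦⟧ : ∀ m → toℕ ⟦ m ⟧ ≡ m % p
  toℕ-⟦⟧ m = toℕ-fromℕ< (m%n<n m p)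

  toℕ-⟦⟧-< : ∀ {m} → m ℕ.< p → toℕ ⟦ m ⟧ ≡ m
  toℕ-⟦⟧-< {m} m<p = trans (toℕ-⟦⟧ m) (m<n⇒m%n≡m m<p)

  ⟦⟧-cong-% : ∀ {m n} → m % p ≡ n % p → ⟦ m ⟧ ≡ ⟦ n ⟧
  ⟦⟧-cong-% {m} {n} eq = toℕ-injective (trans (toℕ-⟦⟧ m) (trans eq (sym (toℕ-⟦⟧ n))))

  ⟦toℕ⟧ : ∀ x → ⟦ toℕ x ⟧ ≡ x
  ⟦toℕ⟧ x = toℕ-injective (toℕ-⟦⟧-< (toℕ<n x))

  -- ⟦_⟧ is a surjective semiring homomorphism from ℕ, so F inherits the ring laws of ℕ.
  ⟦⟧-elim : {P : F → Set} → (∀ m → P ⟦ m ⟧) → ∀ x → P x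
  ⟦⟧-elim {P} h x = subst P (⟦toℕ⟧ x) (h (toℕ x))

  ⟦⟧-homo-+ : ∀ m n → ⟦ m ℕ.+ n ⟧ ≡ ⟦ m ⟧ + ⟦ n ⟧
  ⟦⟧-homo-+ m n = ⟦⟧-cong-% (begin
    (m ℕ.+ n) % p                  ≡⟨ %-distribˡ-+ m n p ⟩
    (m % p ℕ.+ n % p) % p          ≡⟨ cong₂ (λ i j → (i ℕ.+ j) % p) (toℕ-⟦⟧ m) (toℕ-⟦⟧ n) ⟨
    (toℕ ⟦ m ⟧ ℕ.+ toℕ ⟦ n ⟧) % p  ∎)

  ⟦⟧-homo-* : ∀ m n → ⟦ m ℕ.* n ⟧ ≡ ⟦ m ⟧ * ⟦ n ⟧
  ⟦⟧-homo-* m n = ⟦⟧-cong-% (begin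
    (m ℕ.* n) % p                  ≡⟨ %-distribˡ-* m n p ⟩
    (m % p ℕ.* (n % p)) % p        ≡⟨ cong₂ (λ i j → (i ℕ.* j) % p) (toℕ-⟦⟧ m) (toℕ-⟦⟧ n) ⟨
    (toℕ ⟦ m ⟧ ℕ.* toℕ ⟦ n ⟧) % p  ∎)

  open import Algebra.Definitions {A = F} _≡_
  open import Algebra.Structures {A = F} _≡_ using (IsCommutativeRing)
  open import Algebra.Consequences.Propositional {A = F}
    using (comm∧idˡ⇒id; comm∧invˡ⇒inv; comm∧distrʳ⇒distrˡ)

  +-comm : Commutative _+_
  +-comm x y = cong ⟦_⟧ (ℕ.+-comm (toℕ x) (toℕ y))

  *-comm : Commutative _*_
  *-comm x y = cong ⟦_⟧ (ℕ.*-comm (toℕ x) (toℕ y))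

  +-identityˡ : LeftIdentity 0# _+_
  +-identityˡ = ⟦⟧-elim λ i → sym (⟦⟧-homo-+ 0 i)

  *-identityˡ : LeftIdentity 1# _*_
  *-identityˡ = ⟦⟧-elim λ i → trans (sym (⟦⟧-homo-* 1 i)) (cong ⟦_⟧ (ℕ.*-identityˡ i))

  -‿inverseˡ : LeftInverse 0# -_ _+_
  -‿inverseˡ x = begin
    - x + x                      ≡⟨ cong (_+_ (- x)) (⟦toℕ⟧ x) ⟨
    ⟦ p ∸ toℕ x ⟧ + ⟦ toℕ x ⟧    ≡⟨ ⟦⟧-homo-+ (p ∸ toℕ x) (toℕ x) ⟨
    ⟦ p ∸ toℕ x ℕ.+ toℕ x ⟧      ≡⟨ cong ⟦_⟧ (ℕ.m∸n+n≡m (ℕ.<⇒≤ (toℕ<n x))) ⟩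
    ⟦ p ⟧                        ≡⟨ ⟦⟧-cong-% (trans (n%n≡0 p) (sym (m<n⇒m%n≡m 0<p))) ⟩
    0#                           ∎

  +-assoc : Associative _+_
  +-assoc = ⟦⟧-elim λ i → ⟦⟧-elim λ j → ⟦⟧-elim λ k → begin
    ⟦ i ⟧ + ⟦ j ⟧ + ⟦ k ⟧        ≡⟨ trans (⟦⟧-homo-+ (i ℕ.+ j) k) (cong (_+ ⟦ k ⟧) (⟦⟧-homo-+ i j)) ⟨
    ⟦ i ℕ.+ j ℕ.+ k ⟧            ≡⟨ cong ⟦_⟧ (ℕ.+-assoc i j k) ⟩
    ⟦ i ℕ.+ (j ℕ.+ k) ⟧          ≡⟨ trans (⟦⟧-homo-+ i (j ℕ.+ k)) (cong (_+_ ⟦ i ⟧) (⟦⟧-homo-+ j k)) ⟩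
    ⟦ i ⟧ + (⟦ j ⟧ + ⟦ k ⟧)      ∎

  *-assoc : Associative _*_
  *-assoc = ⟦⟧-elim λ i → ⟦⟧-elim λ j → ⟦⟧-elim λ k → begin
    ⟦ i ⟧ * ⟦ j ⟧ * ⟦ k ⟧        ≡⟨ trans (⟦⟧-homo-* (i ℕ.* j) k) (cong (_* ⟦ k ⟧) (⟦⟧-homo-* i j)) ⟨
    ⟦ i ℕ.* j ℕ.* k ⟧            ≡⟨ cong ⟦_⟧ (ℕ.*-assoc i j k) ⟩
    ⟦ i ℕ.* (j ℕ.* k) ⟧          ≡⟨ trans (⟦⟧-homo-* i (j ℕ.* k)) (cong (⟦ i ⟧ *_) (⟦⟧-homo-* j k)) ⟩
    ⟦ i ⟧ * (⟦ j ⟧ * ⟦ k ⟧)      ∎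

  *-distribʳ-+ : _*_ DistributesOverʳ _+_
  *-distribʳ-+ = ⟦⟧-elim λ k → ⟦⟧-elim λ i → ⟦⟧-elim λ j → begin
    (⟦ i ⟧ + ⟦ j ⟧) * ⟦ k ⟧          ≡⟨ trans (⟦⟧-homo-* (i ℕ.+ j) k) (cong (_* ⟦ k ⟧) (⟦⟧-homo-+ i j)) ⟨
    ⟦ (i ℕ.+ j) ℕ.* k ⟧              ≡⟨ cong ⟦_⟧ (ℕ.*-distribʳ-+ k i j) ⟩
    ⟦ i ℕ.* k ℕ.+ j ℕ.* k ⟧          ≡⟨ trans (⟦⟧-homo-+ (i ℕ.* k) (j ℕ.* k))
                                              (cong₂ _+_ (⟦⟧-homo-* i k) (⟦⟧-homo-* j k)) ⟩
    ⟦ i ⟧ * ⟦ k ⟧ + ⟦ j ⟧ * ⟦ k ⟧    ∎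

  +-*-isCommutativeRing : IsCommutativeRing _+_ _*_ -_ 0# 1#
  +-*-isCommutativeRing = record
    { isRing = record
      { +-isAbelianGroup = record
        { isGroup = record
          { isMonoid = record
            { isSemigroup = record
              { isMagma = record { isEquivalence = isEquivalence ; ∙-cong = cong₂ _+_ }
              ; assoc   = +-assoc
              }
            ; identity = comm∧idˡ⇒id +-comm +-identityˡ
            }
          ; inverse = comm∧invˡ⇒inv +-comm -‿inverseˡ
          ; ⁻¹-cong = cong -_
          }
        ; comm = +-comm
        }
      ; *-cong     = cong₂ _*_
      ; *-assoc    = *-assoc
      ; *-identity = comm∧idˡ⇒id *-comm *-identityˡ
      ; distrib    = comm∧distrʳ⇒distrˡ *-comm *-distribʳ-+ , *-distribʳ-+
      }
    ; *-comm = *-comm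
    }

  +-*-commutativeRing : CommutativeRing 0ℓ 0ℓ
  +-*-commutativeRing = record { isCommutativeRing = +-*-isCommutativeRing }

  private module R = CommutativeRing +-*-commutativeRing
  open R using (*-identityʳ; zeroˡ) public
  open import Algebra.Properties.Group R.+-group using (identityʳ-unique; inverseʳ-unique) public
  open import Algebra.Properties.Ring R.ring using (-‿distribˡ-*) public
  open import Algebra.Properties.CommutativeSemigroup R.*-commutativeSemigroup
    using (x∙yz≈y∙xz; x∙yz≈yx∙z) public

  toℕ-0# : toℕ 0# ≡ 0
  toℕ-0# = toℕ-⟦⟧-< 0<p

  toℕ-1# : toℕ 1# ≡ 1
  toℕ-1# = toℕ-⟦⟧-< (ℕ.nonTrivial⇒n>1 p {{prime⇒nonTrivial pr}})

  1#≢0# : 1# ≢ 0#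
  1#≢0# 1≡0 with trans (sym toℕ-1#) (trans (cong toℕ 1≡0) toℕ-0#)
  ... | ()

  ≢0#∧≢1#⇒2≤toℕ : ∀ {x} → x ≢ 0# → x ≢ 1# → 2 ≤ toℕ x
  ≢0#∧≢1#⇒2≤toℕ {x} x≢0 x≢1 with toℕ x in eq
  ... | 0           = contradiction (toℕ-injective (trans eq (sym toℕ-0#))) x≢0
  ... | 1           = contradiction (toℕ-injective (trans eq (sym toℕ-1#))) x≢1
  ... | suc (suc _) = s≤s (s≤s z≤n)

  2≤toℕ⇒≢0# : ∀ {x} → 2 ≤ toℕ x → x ≢ 0#
  2≤toℕ⇒≢0# 2≤x refl with subst (2 ≤_) toℕ-0# 2≤x
  ... | ()

  2≤toℕ⇒≢1# : ∀ {x} → 2 ≤ toℕ x → x ≢ 1#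
  2≤toℕ⇒≢1# 2≤x refl with subst (2 ≤_) toℕ-1# 2≤x
  ... | s≤s ()

  -2# : F
  -2# = - (1# + 1#)

  toℕ-2# : 2 ℕ.< p → toℕ -2# ≡ p ∸ 2
  toℕ-2# 2<p = begin
    toℕ ⟦ p ∸ toℕ (1# + 1#) ⟧   ≡⟨ cong (λ t → toℕ ⟦ p ∸ t ⟧) toℕ-1+1 ⟩
    toℕ ⟦ p ∸ 2 ⟧               ≡⟨ toℕ-⟦⟧-< (ℕ.∸-monoʳ-< {o = 0} (s≤s z≤n) (ℕ.<⇒≤ 2<p)) ⟩
    p ∸ 2                       ∎
    where
    toℕ-1+1 : toℕ (1# + 1#) ≡ 2
    toℕ-1+1 = trans (cong (λ t → toℕ ⟦ t ℕ.+ t ⟧) toℕ-1#) (toℕ-⟦⟧-< 2<p)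

  x+x+y≡0⇒y≡-2x : ∀ {x y} → x + x + y ≡ 0# → y ≡ -2# * x
  x+x+y≡0⇒y≡-2x {x} {y} x+x+y≡0 = begin
    y                    ≡⟨ inverseʳ-unique (x + x) y x+x+y≡0 ⟩
    - (x + x)            ≡⟨ cong -_ (trans (*-distribʳ-+ x 1# 1#) (cong₂ _+_ (*-identityˡ x) (*-identityˡ x))) ⟨
    - ((1# + 1#) * x)    ≡⟨ -‿distribˡ-* (1# + 1#) x ⟩
    -2# * x              ∎

  *-inverse-unique : ∀ {x y z} → x * z ≡ 1# → y * z ≡ 1# → x ≡ y
  *-inverse-unique {x} {y} {z} xz≡1 yz≡1 = begin
    x              ≡⟨ *-identityʳ x ⟨
    x * 1#         ≡⟨ cong (x *_) yz≡1 ⟨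
    x * (y * z)    ≡⟨ x∙yz≈y∙xz x y z ⟩
    y * (x * z)    ≡⟨ cong (y *_) xz≡1 ⟩
    y * 1#         ≡⟨ *-identityʳ y ⟩
    y              ∎

  ^-homo-+ : ∀ b i j → b ^ (i ℕ.+ j) ≡ b ^ i * b ^ j
  ^-homo-+ b zero    j = sym (*-identityˡ (b ^ j))
  ^-homo-+ b (suc i) j = trans (cong (b *_) (^-homo-+ b i j)) (sym (*-assoc b (b ^ i) (b ^ j)))

  ^≢0# : ∀ {b k i} → b ^ k ≡ 1# → i ≤ k → b ^ i ≢ 0#
  ^≢0# {b} {k} {i} b^k≡1 i≤k b^i≡0 = 1#≢0# (begin
    1#                     ≡⟨ b^k≡1 ⟨
    b ^ k                  ≡⟨ cong (b ^_) (ℕ.m+[n∸m]≡n i≤k) ⟨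
    b ^ (i ℕ.+ (k ∸ i))    ≡⟨ ^-homo-+ b i (k ∸ i) ⟩
    b ^ i * b ^ (k ∸ i)    ≡⟨ cong (_* b ^ (k ∸ i)) b^i≡0 ⟩
    0# * b ^ (k ∸ i)       ≡⟨ zeroˡ (b ^ (k ∸ i)) ⟩
    0#                     ∎)

  ^i≡^j⇒^[k∸j+i]≡1 : ∀ {b k i j} → b ^ k ≡ 1# → j ≤ k → b ^ i ≡ b ^ j → b ^ (k ∸ j ℕ.+ i) ≡ 1#
  ^i≡^j⇒^[k∸j+i]≡1 {b} {k} {i} {j} b^k≡1 j≤k b^i≡b^j = begin
    b ^ (k ∸ j ℕ.+ i)      ≡⟨ ^-homo-+ b (k ∸ j) i ⟩
    b ^ (k ∸ j) * b ^ i    ≡⟨ cong (b ^ (k ∸ j) *_) b^i≡b^j ⟩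
    b ^ (k ∸ j) * b ^ j    ≡⟨ ^-homo-+ b (k ∸ j) j ⟨
    b ^ (k ∸ j ℕ.+ j)      ≡⟨ cong (b ^_) (ℕ.m∸n+n≡m j≤k) ⟩
    b ^ k                  ≡⟨ b^k≡1 ⟩
    1#                     ∎

  primitiveRoot⇒^-distinct : ∀ {b i j} → PrimitiveRoot b → i ℕ.< j → j ℕ.< p ∸ 1 → b ^ i ≢ b ^ j
  primitiveRoot⇒^-distinct {b} {i} {j} (b^q≡1 , minimal) i<j j<q b^i≡b^j =
    minimal (p ∸ 1 ∸ j ℕ.+ i) 1≤k k<q (^i≡^j⇒^[k∸j+i]≡1 b^q≡1 (ℕ.<⇒≤ j<q) b^i≡b^j)
    where
    1≤k : 1 ≤ p ∸ 1 ∸ j ℕ.+ i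
    1≤k = ℕ.≤-trans (ℕ.m<n⇒0<n∸m j<q) (ℕ.m≤m+n (p ∸ 1 ∸ j) i)

    k<q : p ∸ 1 ∸ j ℕ.+ i ℕ.< p ∸ 1
    k<q = subst (p ∸ 1 ∸ j ℕ.+ i ℕ.<_) (ℕ.m∸n+n≡m (ℕ.<⇒≤ j<q)) (ℕ.+-monoʳ-< (p ∸ 1 ∸ j) i<j)

  primitiveRoot⇒^-injective : ∀ {b i j} → PrimitiveRoot b → i ℕ.< p ∸ 1 → j ℕ.< p ∸ 1 →
                              b ^ i ≡ b ^ j → i ≡ j
  primitiveRoot⇒^-injective {i = i} {j} prim i<q j<q b^i≡b^j with ℕ.<-cmp i j
  ... | tri< i<j _ _ = contradiction b^i≡b^j (primitiveRoot⇒^-distinct prim i<j j<q)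
  ... | tri≈ _ i≡j _ = i≡j
  ... | tri> _ _ j<i = contradiction (sym b^i≡b^j) (primitiveRoot⇒^-distinct prim j<i i<q)

module Sequences (p : ℕ) (pr : Prime p) where
  open Fp p pr
  open PrimeField p pr
  open ≡-Reasoning

  Geometric : F → (ℤ → F) → Set
  Geometric b a = ∀ z → a (z ℤ.+ + 1) ≡ b * a z

  private
    +k+1≡+[1+k] : ∀ k → + k ℤ.+ + 1 ≡ + suc k
    +k+1≡+[1+k] k = cong +_ (ℕ.+-comm k 1)

  geometric⇒IsZPow : ∀ {b a} → a (+ 0) ≡ 1# → Geometric b a → ∀ z → IsZPow b z (a z)
  geometric⇒IsZPow {b} {a} a₀≡1 step = λ { (+ k) → nonneg k ; -[1+ k ] → neg k }
    where
    nonneg : ∀ k → a (+ k) ≡ b ^ k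
    nonneg zero    = a₀≡1
    nonneg (suc k) = begin
      a (+ suc k)          ≡⟨ cong a (+k+1≡+[1+k] k) ⟨
      a (+ k ℤ.+ + 1)      ≡⟨ step (+ k) ⟩
      b * a (+ k)          ≡⟨ cong (b *_) (nonneg k) ⟩
      b * b ^ k            ∎

    shift : ∀ k → a -[1+ k ] * b ^ suc k ≡ a (-[1+ k ] ℤ.+ + 1) * b ^ k
    shift k = trans (x∙yz≈yx∙z (a -[1+ k ]) b (b ^ k)) (cong (_* b ^ k) (sym (step -[1+ k ])))

    neg : ∀ k → a -[1+ k ] * b ^ suc k ≡ 1#
    neg zero    = trans (shift 0) (trans (*-identityʳ (a (+ 0))) a₀≡1)
    neg (suc k) = trans (shift (suc k)) (neg k)

  IsZPow⇒geometric : ∀ {b a} → (∀ z → IsZPow b z (a z)) → Geometric b a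
  IsZPow⇒geometric {b} {a} pow (+ k) = begin
    a (+ k ℤ.+ + 1)      ≡⟨ cong a (+k+1≡+[1+k] k) ⟩
    a (+ suc k)          ≡⟨ pow (+ suc k) ⟩
    b * b ^ k            ≡⟨ cong (b *_) (pow (+ k)) ⟨
    b * a (+ k)          ∎
  IsZPow⇒geometric {b} {a} pow -[1+ 0 ] = begin
    a (+ 0)              ≡⟨ pow (+ 0) ⟩
    1#                   ≡⟨ pow -[1+ 0 ] ⟨
    a -[1+ 0 ] * b ^ 1   ≡⟨ cong (a -[1+ 0 ] *_) (*-identityʳ b) ⟩
    a -[1+ 0 ] * b       ≡⟨ *-comm (a -[1+ 0 ]) b ⟩
    b * a -[1+ 0 ]       ∎
  IsZPow⇒geometric {b} {a} pow -[1+ suc k ] =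
    *-inverse-unique (pow -[1+ k ])
      (trans (sym (x∙yz≈yx∙z (a -[1+ suc k ]) b (b ^ suc k))) (pow -[1+ suc k ]))

  geometric-+ : ∀ {b a} → Geometric b a → ∀ z k → a (z ℤ.+ + k) ≡ b ^ k * a z
  geometric-+ {b} {a} step z zero    = trans (cong a (ℤ.+-identityʳ z)) (sym (*-identityˡ (a z)))
  geometric-+ {b} {a} step z (suc k) = begin
    a (z ℤ.+ + suc k)           ≡⟨ cong a (trans (ℤ.+-assoc z (+ k) (+ 1)) (cong (ℤ._+_ z) (+k+1≡+[1+k] k))) ⟨
    a (z ℤ.+ + k ℤ.+ + 1)       ≡⟨ step (z ℤ.+ + k) ⟩
    b * a (z ℤ.+ + k)           ≡⟨ cong (b *_) (geometric-+ step z k) ⟩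
    b * (b ^ k * a z)           ≡⟨ *-assoc b (b ^ k) (a z) ⟨
    b ^ suc k * a z             ∎

  IsZPow-base-unique : ∀ {a : ℤ → F} {b c} → (∀ z → IsZPow b z (a z)) → (∀ z → IsZPow c z (a z)) → b ≡ c
  IsZPow-base-unique {a} {b} {c} powb powc = begin
    b          ≡⟨ *-identityʳ b ⟨
    b ^ 1      ≡⟨ powb (+ 1) ⟨
    a (+ 1)    ≡⟨ powc (+ 1) ⟩
    c ^ 1      ≡⟨ *-identityʳ c ⟩
    c          ∎

  Φ-root : ∀ {κ a b} → PhiSeq κ a → (∀ z → IsZPow b z (a z)) → b ^ κ ≡ b + 1#
  Φ-root {κ} {a} {b} (a₀≡1 , recurrence) pow = begin
    b ^ κ                ≡⟨ pow (+ κ) ⟨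
    a (+ κ)              ≡⟨ recurrence (+ 0) ⟩
    a (+ 0) + a (+ 1)    ≡⟨ cong₂ _+_ a₀≡1 (trans (pow (+ 1)) (*-identityʳ b)) ⟩
    1# + b               ≡⟨ +-comm 1# b ⟩
    b + 1#               ∎

  Φ-period⇒geometric : ∀ {κ a} → PhiSeq κ a → (∀ z → a (z ℤ.+ + (κ ℕ.+ κ)) ≡ a z) → Geometric -2# a
  Φ-period⇒geometric {κ} {a} (_ , recurrence) period z =
    subst (λ w → a (w ℤ.+ + 1) ≡ -2# * a w) [z-1]+1≡z (step (z ℤ.+ -[1+ 0 ]))
    where
    unfold : ∀ w → a (w ℤ.+ + (κ ℕ.+ κ)) ≡ a w + (a (w ℤ.+ + 1) + a (w ℤ.+ + 1) + a (w ℤ.+ + 1 ℤ.+ + 1))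
    unfold w = begin
      a (w ℤ.+ + (κ ℕ.+ κ))                  ≡⟨ cong a (ℤ.+-assoc w (+ κ) (+ κ)) ⟨
      a (w ℤ.+ + κ ℤ.+ + κ)                  ≡⟨ recurrence (w ℤ.+ + κ) ⟩
      a (w ℤ.+ + κ) + a (w ℤ.+ + κ ℤ.+ + 1)  ≡⟨ cong (λ t → a (w ℤ.+ + κ) + a t) (ℤ+.xy∙z≈xz∙y w (+ κ) (+ 1)) ⟩
      a (w ℤ.+ + κ) + a (w ℤ.+ + 1 ℤ.+ + κ)  ≡⟨ cong₂ _+_ (recurrence w) (recurrence (w ℤ.+ + 1)) ⟩
      (a w + u) + (u + v)                     ≡⟨ +-assoc (a w) u (u + v) ⟩
      a w + (u + (u + v))                     ≡⟨ cong (_+_ (a w)) (+-assoc u u v) ⟨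
      a w + (u + u + v)                       ∎
      where
      u v : F
      u = a (w ℤ.+ + 1)
      v = a (w ℤ.+ + 1 ℤ.+ + 1)

    step : ∀ w → a (w ℤ.+ + 1 ℤ.+ + 1) ≡ -2# * a (w ℤ.+ + 1)
    step w = x+x+y≡0⇒y≡-2x (identityʳ-unique (a w) _ (trans (sym (unfold w)) (period w)))

    [z-1]+1≡z : z ℤ.+ -[1+ 0 ] ℤ.+ + 1 ≡ z
    [z-1]+1≡z = trans (ℤ.+-assoc z -[1+ 0 ] (+ 1)) (ℤ.+-identityʳ z)

-- Writing p = suc (suc n) makes p ∸ 1 = suc n and p ∸ 2 = n hold definitionally.
module Completeness (n : ℕ) (pr : Prime (suc (suc n))) where
  open Fp (suc (suc n)) pr
  open PrimeField (suc (suc n)) pr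
  open Sequences (suc (suc n)) pr
  open ≡-Reasoning

  primitiveRoot⇒powers-cover : ∀ {b x} → PrimitiveRoot b → x ≢ 0# → ∃ λ i → i ℕ.< suc n × b ^ i ≡ x
  primitiveRoot⇒powers-cover {b} prim@(b^q≡1 , _) x≢0 =
    let i , b^i≡x = injective∧avoids⇒covers-rest pow-inj pow≢0 x≢0 in toℕ i , toℕ<n i , b^i≡x
    where
    pow : Fin (suc n) → F
    pow i = b ^ toℕ i

    pow-inj : Injective _≡_ _≡_ pow
    pow-inj {i} {j} eq = toℕ-injective (primitiveRoot⇒^-injective prim (toℕ<n i) (toℕ<n j) eq)

    pow≢0 : ∀ i → pow i ≢ 0#
    pow≢0 i = ^≢0# b^q≡1 (ℕ.<⇒≤ (toℕ<n i))

  complete⇒primitiveRoot : ∀ {a b} → Complete a → (∀ z → IsZPow b z (a z)) → PrimitiveRoot b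
  complete⇒primitiveRoot {a} {b} (period , values) pow = b^q≡1 , minimal
    where
    b^q≡1 : b ^ suc n ≡ 1#
    b^q≡1 = begin
      b ^ suc n    ≡⟨ pow (+ suc n) ⟨
      a (+ suc n)  ≡⟨ period (+ 0) ⟩
      a (+ 0)      ≡⟨ pow (+ 0) ⟩
      1#           ∎

    minimal : ∀ k → 1 ≤ k → k ℕ.< suc n → b ^ k ≢ 1#
    minimal k 1≤k k<q = 2≤toℕ⇒≢1# (proj₁ (proj₁ (values (b ^ k)) (k , 1≤k , ℕ.≤-pred k<q , pow (+ k))))

  primitiveRoot⇒complete : ∀ {a b} → PrimitiveRoot b → (∀ z → IsZPow b z (a z)) → Complete a
  primitiveRoot⇒complete {a} {b} prim@(b^q≡1 , minimal) pow = period , λ x → in-range x , attained x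
    where
    period : ∀ z → a (z ℤ.+ + suc n) ≡ a z
    period z = begin
      a (z ℤ.+ + suc n)   ≡⟨ geometric-+ {b} {a} (IsZPow⇒geometric pow) z (suc n) ⟩
      b ^ suc n * a z     ≡⟨ cong (_* a z) b^q≡1 ⟩
      1# * a z            ≡⟨ *-identityˡ (a z) ⟩
      a z                 ∎

    in-range : ∀ x → (Σ ℕ λ i → 1 ≤ i × i ≤ n × a (+ i) ≡ x) → 2 ≤ toℕ x × toℕ x ≤ suc n
    in-range x (i , 1≤i , i≤n , a[i]≡x) =
      subst (λ y → 2 ≤ toℕ y) (trans (sym (pow (+ i))) a[i]≡x)
        (≢0#∧≢1#⇒2≤toℕ (^≢0# b^q≡1 (ℕ.m≤n⇒m≤1+n i≤n)) (minimal i 1≤i (s≤s i≤n))) ,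
      toℕ≤pred[n] x

    attained : ∀ x → 2 ≤ toℕ x × toℕ x ≤ suc n → Σ ℕ λ i → 1 ≤ i × i ≤ n × a (+ i) ≡ x
    attained x (2≤x , _) = nonzero-exponent (primitiveRoot⇒powers-cover prim (2≤toℕ⇒≢0# 2≤x))
      where
      nonzero-exponent : (∃ λ i → i ℕ.< suc n × b ^ i ≡ x) → Σ ℕ λ i → 1 ≤ i × i ≤ n × a (+ i) ≡ x
      nonzero-exponent (zero  , _       , 1≡x)   = contradiction (sym 1≡x) (2≤toℕ⇒≢1# 2≤x)
      nonzero-exponent (suc i , s≤s i<n , b^i≡x) = suc i , s≤s z≤n , i<n , trans (pow (+ suc i)) b^i≡x

theorem5p7 : (p : ℕ) (pr : Prime p) → 5 ≤ p →
    let open Fp p pr in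
    (a : ℤ → F) → PhiSeq ((p ∸ 1) / 2) a →
      ((Complete a → Σ F λ b → PhiPrimRoot ((p ∸ 1) / 2) b × (∀ (n : ℤ) → IsZPow b n (a n))) ×
       ((Σ F λ b → PhiPrimRoot ((p ∸ 1) / 2) b × (∀ (n : ℤ) → IsZPow b n (a n))) → Complete a)) ×
      (Complete a → (b : F) → PhiPrimRoot ((p ∸ 1) / 2) b → (∀ (n : ℤ) → IsZPow b n (a n)) →
        toℕ b ≡ p ∸ 2)
theorem5p7 (suc (suc n)) pr 5≤p a φ =
  (complete⇒Φ-primitiveRoot , λ { (b , (prim , _) , pow) → primitiveRoot⇒complete prim pow }) ,
  λ complete b _ pow → trans (cong toℕ (IsZPow-base-unique pow (complete⇒IsZPow[-2#] complete))) (toℕ-2# 2<p)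
  where
  open Fp (suc (suc n)) pr
  open PrimeField (suc (suc n)) pr
  open Sequences (suc (suc n)) pr
  open Completeness n pr

  2<p : 2 ℕ.< suc (suc n)
  2<p = ℕ.m+n≤o⇒n≤o 2 5≤p

  complete⇒IsZPow[-2#] : Complete a → ∀ z → IsZPow -2# z (a z)
  complete⇒IsZPow[-2#] (period , _) = geometric⇒IsZPow (proj₁ φ) (Φ-period⇒geometric φ period-κ+κ)
    where
    period-κ+κ : ∀ z → a (z ℤ.+ + (suc n / 2 ℕ.+ suc n / 2)) ≡ a z
    period-κ+κ z = subst (λ k → a (z ℤ.+ + k) ≡ a z) (oddPrime⇒pred≡half+half pr 2<p) (period z)

  complete⇒Φ-primitiveRoot : Complete a → Σ F λ b → PhiPrimRoot (suc n / 2) b × (∀ z → IsZPow b z (a z))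
  complete⇒Φ-primitiveRoot complete =
    -2# , (complete⇒primitiveRoot complete pow , Φ-root φ pow) , pow
    where
    pow : ∀ z → IsZPow -2# z (a z)
    pow = complete⇒IsZPow[-2#] complete
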